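{- For $r \in \{7,9,10,12\}$ there is no pentagonal geometry $\mathrm{PENT}(3,r)$ having exactly two opposite line pairs.
   Context: A $\mathrm{PLS}(k,r)$ is a finite set of points with a family of $k$-element subsets (lines), $k\ge 2$, such that any two distinct points lie in at most one line and every point lies on exactly $r\ge 1$ lines. A pentagonal geometry $\mathrm{PENT}(k,r)$ is a $\mathrm{PLS}(k,r)$ such that for every point $x$, the set of points distinct from $x$ not lying on a common line with $x$ is itself a line, denoted $x^{\mathrm{opp}}$ (the opposite line of $x$). An opposite line pair is a pair of distinct lines $(l,m)$ such that $x^{\mathrm{opp}}=l$ for every point $x\in m$ and $y^{\mathrm{opp}}=m$ for every point $y \in l$. -}

module Defs where

open import Data.Nat using (ℕ)
open import Data.Fin using (Fin)
open import Data.Fin.Subset using (Subset; _∈_; ∣_∣)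
open import Data.Vec using (tabulate; lookup)
open import Data.Product using (Σ; ∃; _×_)
open import Data.Sum using (_⊎_)
open import Relation.Nullary using (¬_)
open import Relation.Binary.PropositionalEquality using (_≡_; _≢_)
open import Function.Bundles using (_⇔_)

record PLS (k r : ℕ) : Set where
  field
    v b       : ℕ
    line      : Fin b → Subset v
    lineSize  : ∀ l → ∣ line l ∣ ≡ k
    atMostOne : ∀ (x y : Fin v) → x ≢ y → ∀ (l m : Fin b) →
                x ∈ line l → y ∈ line l → x ∈ line m → y ∈ line m → l ≡ m
    degree    : ∀ (x : Fin v) → ∣ tabulate (λ l → lookup (line l) x) ∣ ≡ r

  Collinear : Fin v → Fin v → Set
  Collinear x y = ∃ λ l → x ∈ line l × y ∈ line l

  IsOpp : Fin v → Fin b → Set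
  IsOpp x l = ∀ y → (y ∈ line l) ⇔ (y ≢ x × ¬ Collinear x y)

  OppPair : Fin b → Fin b → Set
  OppPair l m = l ≢ m × (∀ x → x ∈ line m → IsOpp x l) × (∀ y → y ∈ line l → IsOpp y m)

record PENT (k r : ℕ) : Set where
  field
    pls  : PLS k r
  open PLS pls public
  field
    opp  : ∀ x → Σ (Fin b) (IsOpp x)

ExactlyTwoOppPairs : ∀ {k r} → PENT k r → Set
ExactlyTwoOppPairs P =
  Σ (Fin b) λ l₁ → Σ (Fin b) λ m₁ → Σ (Fin b) λ l₂ → Σ (Fin b) λ m₂ →
    OppPair l₁ m₁ × OppPair l₂ m₂ ×
    ¬ ((l₁ ≡ l₂ × m₁ ≡ m₂) ⊎ (l₁ ≡ m₂ × m₁ ≡ l₂)) ×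
    (∀ l m → OppPair l m →
       (l ≡ l₁ × m ≡ m₁) ⊎ (l ≡ m₁ × m ≡ l₁) ⊎ (l ≡ l₂ × m ≡ m₂) ⊎ (l ≡ m₂ × m ≡ l₂))
  where open PENT P

module Submission where

-- Let A be the twelve points on the four lines of the two opposite line pairs
-- (l₁, m₁), (l₂, m₂) and B the remaining points. Counting incidences through a
-- single point gives v ≥ 2r + 4, hence |B| ≥ 2r − 8.
--
-- Fix y ∈ B. Every point of A is collinear with y, and a line through y meets
-- each pair in at most one point. The opposite lines of the three points of
-- y^opp pass through y and miss A; they are distinct, because two points with a
-- common opposite line span an opposite line pair, which would be a third one.
-- So the twelve points of A lie on at most r − 3 lines through y, which forces
-- t(y) := Σ_{ℓ ∋ y} |ℓ ∩ (l₁ ∪ m₁)| · |ℓ ∩ (l₂ ∪ m₂)| ≥ 15 − r.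
--
-- On the other hand Σ_{y ∈ B} t(y) ≤ 36: a line meeting both pairs has at most
-- one point in B, and at most 6 · 6 pairs of points from the two pairs are
-- collinear. Thus (2r − 8)(15 − r) ≤ 36, which fails for r ∈ {7, 9, 10, 12}.

open import Defs
open import Data.Bool.Base using (if_then_else_)
open import Data.Empty using (⊥)
open import Data.Fin.Base using (Fin; zero; suc)
open import Data.Fin.Properties using (_≟_; any?)
import Data.Fin.Properties as Fin
open import Data.Fin.Subset using (Subset; _∈_; _∉_; ∣_∣; inside; outside)
open import Data.Fin.Subset.Properties using (_∈?_)
open import Data.Nat.Base using (ℕ; zero; suc; _+_; _*_; _∸_; _≤_; _<_; z≤n; s≤s)
open import Data.Nat.Properties hiding (_≟_)
import Data.Nat.Properties as Nat
open import Algebra.Properties.Semiring.Sum +-*-semiring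
  using (sum; sum-cong-≗; sum-replicate-zero; ∑-distrib-+; ∑-comm; *-distribˡ-sum; *-distribʳ-sum)
open import Data.Product using (∃; ∃₂; _×_; _,_; proj₁; proj₂)
open import Data.Sum using (_⊎_; inj₁; inj₂)
open import Data.Vec.Base using ([]; _∷_; lookup; tabulate)
open import Data.Vec.Properties using ([]=⇒lookup; lookup⇒[]=; lookup∘tabulate)
open import Function.Base using (_∘_)
open import Function.Bundles using (_⇔_; mk⇔; Equivalence)
open import Relation.Nullary using (¬_; Dec; yes; no; does; contradiction)
open import Relation.Nullary.Decidable using (_×-dec_; _⊎-dec_; ¬?; decidable-stable; from-no)
open import Relation.Binary.PropositionalEquality
  using (_≡_; _≢_; refl; sym; trans; cong; cong₂; subst; subst₂; module ≡-Reasoning)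

private
  variable
    n : ℕ
    A B : Set

-- Indicators and finite sums

𝟙 : Dec A → ℕ
𝟙 a? = if does a? then 1 else 0

𝟙-yes : (a? : Dec A) → A → 𝟙 a? ≡ 1
𝟙-yes (yes _) _ = refl
𝟙-yes (no ¬a) a = contradiction a ¬a

𝟙-no : (a? : Dec A) → ¬ A → 𝟙 a? ≡ 0
𝟙-no (yes a) ¬a = contradiction a ¬a
𝟙-no (no _)  _  = refl

𝟙>0⇒ : (a? : Dec A) → 0 < 𝟙 a? → A
𝟙>0⇒ (yes a) _ = a

𝟙-cong : (a? : Dec A) (b? : Dec B) → A ⇔ B → 𝟙 a? ≡ 𝟙 b?
𝟙-cong (yes a) b? a⇔b = sym (𝟙-yes b? (Equivalence.to a⇔b a))
𝟙-cong (no ¬a) b? a⇔b = sym (𝟙-no b? (¬a ∘ Equivalence.from a⇔b))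

𝟙-idem : (a? : Dec A) → 𝟙 a? * 𝟙 a? ≡ 𝟙 a?
𝟙-idem (yes _) = refl
𝟙-idem (no _)  = refl

𝟙-× : (a? : Dec A) (b? : Dec B) → 𝟙 (a? ×-dec b?) ≡ 𝟙 a? * 𝟙 b?
𝟙-× (yes _) (yes _) = refl
𝟙-× (yes _) (no _)  = refl
𝟙-× (no _)  _       = refl

𝟙-⊎ : (a? : Dec A) (b? : Dec B) → ¬ (A × B) → 𝟙 (a? ⊎-dec b?) ≡ 𝟙 a? + 𝟙 b?
𝟙-⊎ (yes a) (yes b) ¬a×b = contradiction (a , b) ¬a×b
𝟙-⊎ (yes _) (no _)  _    = refl
𝟙-⊎ (no _)  _       _    = refl

𝟙-⊎-≤ : (a? : Dec A) (b? : Dec B) → 𝟙 (a? ⊎-dec b?) ≤ 𝟙 a? + 𝟙 b?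
𝟙-⊎-≤ (yes _) _ = m≤m+n 1 _
𝟙-⊎-≤ (no _)  _ = ≤-refl

𝟙-¬ : (a? : Dec A) → 𝟙 (¬? a?) + 𝟙 a? ≡ 1
𝟙-¬ (yes _) = refl
𝟙-¬ (no _)  = refl

𝟙≤𝟙-∖+𝟙 : (a? : Dec A) (b? : Dec B) → 𝟙 a? ≤ 𝟙 (a? ×-dec ¬? b?) + 𝟙 b?
𝟙≤𝟙-∖+𝟙 (yes _) (yes _) = ≤-refl
𝟙≤𝟙-∖+𝟙 (yes _) (no _)  = ≤-refl
𝟙≤𝟙-∖+𝟙 (no _)  _       = z≤n

*-pos⇒pos : ∀ m n → 0 < m * n → 0 < m × 0 < n
*-pos⇒pos zero    n       ()
*-pos⇒pos (suc m) zero    m*0>0 = contradiction (subst (0 <_) (*-zeroʳ (suc m)) m*0>0) λ ()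
*-pos⇒pos (suc m) (suc n) _     = s≤s z≤n , s≤s z≤n

*-monoʳ-≤-pos : ∀ m {n o} → (0 < m → n ≤ o) → m * n ≤ m * o
*-monoʳ-≤-pos zero    _   = z≤n
*-monoʳ-≤-pos (suc m) n≤o = *-monoʳ-≤ (suc m) (n≤o (s≤s z≤n))

m≤m*n-pos : ∀ m n → (0 < m → 0 < n) → m ≤ m * n
m≤m*n-pos m n n>0 = ≤-trans (≤-reflexive (sym (*-identityʳ m))) (*-monoʳ-≤-pos m n>0)

sum-mono-≤ : {f g : Fin n → ℕ} → (∀ i → f i ≤ g i) → sum f ≤ sum g
sum-mono-≤ {zero}  _   = z≤n
sum-mono-≤ {suc n} f≤g = +-mono-≤ (f≤g zero) (sum-mono-≤ (f≤g ∘ suc))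

sum-ones : ∀ n → sum {n} (λ _ → 1) ≡ n
sum-ones zero    = refl
sum-ones (suc n) = cong suc (sum-ones n)

summand≤sum : (f : Fin n → ℕ) (i : Fin n) → f i ≤ sum f
summand≤sum f zero    = m≤m+n (f zero) _
summand≤sum f (suc i) = m≤n⇒m≤o+n (f zero) (summand≤sum (f ∘ suc) i)

positive-summand : (f : Fin n → ℕ) → 0 < sum f → ∃ λ i → 0 < f i
positive-summand {suc n} f sum>0 with f zero in f0
... | suc _ = zero , subst (0 <_) (sym f0) (s≤s z≤n)
... | zero  = let (i , fi>0) = positive-summand (f ∘ suc) sum>0 in suc i , fi>0

sum-𝟙-≟ : (j : Fin n) → sum (λ i → 𝟙 (i ≟ j)) ≡ 1
sum-𝟙-≟ {suc n} zero    = cong suc (sum-replicate-zero n)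
sum-𝟙-≟ {suc n} (suc j) = sum-𝟙-≟ j

sum-𝟙≤1 : {P : Fin n → Set} (P? : ∀ i → Dec (P i)) →
          (∀ {i j} → P i → P j → i ≡ j) → sum (λ i → 𝟙 (P? i)) ≤ 1
sum-𝟙≤1 {zero}  _  _      = z≤n
sum-𝟙≤1 {suc n} P? unique with P? zero
... | yes p₀ = ≤-reflexive (cong suc (trans (sum-cong-≗ others-absent) (sum-replicate-zero n)))
  where
  others-absent : ∀ i → 𝟙 (P? (suc i)) ≡ 0
  others-absent i = 𝟙-no (P? (suc i)) (Fin.0≢1+n ∘ unique p₀)
... | no _ = sum-𝟙≤1 (P? ∘ suc) (λ pᵢ pⱼ → Fin.suc-injective (unique pᵢ pⱼ))

two-positive-summands : (f : Fin n → ℕ) {i j : Fin n} → i ≢ j → 0 < f i → 0 < f j → 2 ≤ sum f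
two-positive-summands f {i} {j} i≢j fi>0 fj>0 = begin
  2
    ≡⟨ cong₂ _+_ (sum-𝟙-≟ i) (sum-𝟙-≟ j) ⟨
  sum (λ x → 𝟙 (x ≟ i)) + sum (λ x → 𝟙 (x ≟ j))
    ≡⟨ ∑-distrib-+ (λ x → 𝟙 (x ≟ i)) (λ x → 𝟙 (x ≟ j)) ⟨
  sum (λ x → 𝟙 (x ≟ i) + 𝟙 (x ≟ j))
    ≤⟨ sum-mono-≤ below-f ⟩
  sum f
    ∎
  where
  open ≤-Reasoning
  below-f : ∀ x → 𝟙 (x ≟ i) + 𝟙 (x ≟ j) ≤ f x
  below-f x with x ≟ i | x ≟ j
  ... | yes refl | yes refl = contradiction refl i≢j
  ... | yes refl | no _     = fi>0
  ... | no _     | yes refl = fj>0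
  ... | no _     | no _     = z≤n

three-positive-summands : (f : Fin n → ℕ) {i j l : Fin n} → i ≢ j → i ≢ l → j ≢ l →
                          0 < f i → 0 < f j → 0 < f l → 3 ≤ sum f
three-positive-summands f {i} {j} {l} i≢j i≢l j≢l fi>0 fj>0 fl>0 = begin
  3                                               ≡⟨ three-masses ⟨
  sum (λ x → 𝟙 (x ≟ i) + 𝟙 (x ≟ j) + 𝟙 (x ≟ l)) ≤⟨ sum-mono-≤ below-f ⟩
  sum f                                           ∎
  where
  open ≤-Reasoning
  three-masses : sum (λ x → 𝟙 (x ≟ i) + 𝟙 (x ≟ j) + 𝟙 (x ≟ l)) ≡ 3
  three-masses = trans (∑-distrib-+ (λ x → 𝟙 (x ≟ i) + 𝟙 (x ≟ j)) (λ x → 𝟙 (x ≟ l)))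
    (cong₂ _+_ (trans (∑-distrib-+ (λ x → 𝟙 (x ≟ i)) (λ x → 𝟙 (x ≟ j)))
                      (cong₂ _+_ (sum-𝟙-≟ i) (sum-𝟙-≟ j)))
               (sum-𝟙-≟ l))
  below-f : ∀ x → 𝟙 (x ≟ i) + 𝟙 (x ≟ j) + 𝟙 (x ≟ l) ≤ f x
  below-f x with x ≟ i | x ≟ j | x ≟ l
  ... | yes refl | yes refl | _        = contradiction refl i≢j
  ... | yes refl | _        | yes refl = contradiction refl i≢l
  ... | _        | yes refl | yes refl = contradiction refl j≢l
  ... | yes refl | no _     | no _     = fi>0
  ... | no _     | yes refl | no _     = fj>0
  ... | no _     | no _     | yes refl = fl>0
  ... | no _     | no _     | no _     = z≤n

member-outside : {P Q : Fin n → Set} (P? : ∀ i → Dec (P i)) (Q? : ∀ i → Dec (Q i)) →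
                 sum (λ i → 𝟙 (Q? i)) < sum (λ i → 𝟙 (P? i)) → ∃ λ i → P i × ¬ Q i
member-outside P? Q? #Q<#P =
  let (i , pos) = positive-summand #P∖Q #P∖Q>0 in i , 𝟙>0⇒ (P? i ×-dec ¬? (Q? i)) pos
  where
  #P∖Q : Fin _ → ℕ
  #P∖Q i = 𝟙 (P? i ×-dec ¬? (Q? i))
  #P∖Q>0 : 0 < sum #P∖Q
  #P∖Q>0 = +-cancelʳ-< (sum (λ i → 𝟙 (Q? i))) 0 (sum #P∖Q) (begin-strict
    sum (λ i → 𝟙 (Q? i))            <⟨ #Q<#P ⟩
    sum (λ i → 𝟙 (P? i))            ≤⟨ sum-mono-≤ (λ i → 𝟙≤𝟙-∖+𝟙 (P? i) (Q? i)) ⟩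
    sum (λ i → #P∖Q i + 𝟙 (Q? i))   ≡⟨ ∑-distrib-+ #P∖Q (λ i → 𝟙 (Q? i)) ⟩
    sum #P∖Q + sum (λ i → 𝟙 (Q? i)) ∎)
    where open ≤-Reasoning

∣p∣≡∑𝟙∈ : (p : Subset n) → ∣ p ∣ ≡ sum (λ i → 𝟙 (i ∈? p))
∣p∣≡∑𝟙∈ []            = refl
∣p∣≡∑𝟙∈ (inside  ∷ p) = cong suc (∣p∣≡∑𝟙∈ p)
∣p∣≡∑𝟙∈ (outside ∷ p) = ∣p∣≡∑𝟙∈ p

0<∣p∣⇒∃∈ : (p : Subset n) → 0 < ∣ p ∣ → ∃ (_∈ p)
0<∣p∣⇒∃∈ p ∣p∣>0 =
  let (i , pos) = positive-summand _ (subst (0 <_) (∣p∣≡∑𝟙∈ p) ∣p∣>0) in i , 𝟙>0⇒ (i ∈? p) pos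

1<∣p∣⇒∃∈≢ : (p : Subset n) → 1 < ∣ p ∣ → ∀ x → ∃ λ y → y ∈ p × y ≢ x
1<∣p∣⇒∃∈≢ p ∣p∣>1 x =
  member-outside (_∈? p) (_≟ x) (subst₂ _<_ (sym (sum-𝟙-≟ x)) (∣p∣≡∑𝟙∈ p) ∣p∣>1)

2<∣p∣⇒∃∈≢≢ : (p : Subset n) → 2 < ∣ p ∣ → ∀ x x' → ∃ λ y → y ∈ p × y ≢ x × y ≢ x'
2<∣p∣⇒∃∈≢≢ p ∣p∣>2 x x' =
  let (y , y∈p , y∉) = member-outside (_∈? p) (λ i → i ≟ x ⊎-dec i ≟ x') #Q<∣p∣
  in y , y∈p , y∉ ∘ inj₁ , y∉ ∘ inj₂
  where
  open ≤-Reasoning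
  #Q<∣p∣ : sum (λ i → 𝟙 (i ≟ x ⊎-dec i ≟ x')) < sum (λ i → 𝟙 (i ∈? p))
  #Q<∣p∣ = begin-strict
    sum (λ i → 𝟙 (i ≟ x ⊎-dec i ≟ x'))
      ≤⟨ sum-mono-≤ (λ i → 𝟙-⊎-≤ (i ≟ x) (i ≟ x')) ⟩
    sum (λ i → 𝟙 (i ≟ x) + 𝟙 (i ≟ x'))
      ≡⟨ ∑-distrib-+ (λ i → 𝟙 (i ≟ x)) (λ i → 𝟙 (i ≟ x')) ⟩
    sum (λ i → 𝟙 (i ≟ x)) + sum (λ i → 𝟙 (i ≟ x'))
      ≡⟨ cong₂ _+_ (sum-𝟙-≟ x) (sum-𝟙-≟ x') ⟩
    2
      <⟨ ∣p∣>2 ⟩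
    ∣ p ∣
      ≡⟨ ∣p∣≡∑𝟙∈ p ⟩
    sum (λ i → 𝟙 (i ∈? p))
      ∎

-- Pentagonal geometries

module PentagonalGeometry {k r : ℕ} (P : PENT k r) (2≤k : 2 ≤ k) where
  open PENT P
  open Equivalence

  private
    variable
      x x' y z : Fin v
      ℓ ℓ' l m l' m' : Fin b

  opp-line : Fin v → Fin b
  opp-line x = proj₁ (opp x)

  isOpp : ∀ x → IsOpp x (opp-line x)
  isOpp x = proj₂ (opp x)

  I : Fin b → Fin v → ℕ
  I ℓ x = 𝟙 (x ∈? line ℓ)

  ∑on : Fin b → (Fin v → ℕ) → ℕ
  ∑on ℓ f = sum (λ z → I ℓ z * f z)

  common : Fin v → Fin v → ℕ
  common x y = sum (λ ℓ → I ℓ x * I ℓ y)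

  ∑I-line : ∀ ℓ → sum (I ℓ) ≡ k
  ∑I-line ℓ = trans (sym (∣p∣≡∑𝟙∈ (line ℓ))) (lineSize ℓ)

  ∈⇔∈-tabulate : x ∈ line ℓ ⇔ ℓ ∈ tabulate (λ l → lookup (line l) x)
  ∈⇔∈-tabulate {x} {ℓ} = mk⇔
    (λ x∈ℓ → lookup⇒[]= ℓ _ (trans (lookup∘tabulate _ ℓ) ([]=⇒lookup x∈ℓ)))
    (λ ℓ∈ → lookup⇒[]= x (line ℓ) (trans (sym (lookup∘tabulate _ ℓ)) ([]=⇒lookup ℓ∈)))

  ∑I-point : ∀ x → sum (λ ℓ → I ℓ x) ≡ r
  ∑I-point x = begin
    sum (λ ℓ → I ℓ x)
      ≡⟨ sum-cong-≗ (λ ℓ → 𝟙-cong (x ∈? line ℓ) (ℓ ∈? lines-through-x) ∈⇔∈-tabulate) ⟩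
    sum (λ ℓ → 𝟙 (ℓ ∈? lines-through-x))
      ≡⟨ ∣p∣≡∑𝟙∈ lines-through-x ⟨
    ∣ lines-through-x ∣
      ≡⟨ degree x ⟩
    r
      ∎
    where
    open ≡-Reasoning
    lines-through-x : Subset b
    lines-through-x = tabulate (λ l → lookup (line l) x)

  point-on : ∀ ℓ → ∃ (_∈ line ℓ)
  point-on ℓ = 0<∣p∣⇒∃∈ (line ℓ) (subst (0 <_) (sym (lineSize ℓ)) (≤-trans (s≤s z≤n) 2≤k))

  two-points-on : ∀ ℓ → ∃₂ λ x₁ x₂ → x₁ ∈ line ℓ × x₂ ∈ line ℓ × x₁ ≢ x₂
  two-points-on ℓ =
    let (x₁ , x₁∈ℓ) = point-on ℓ
        (x₂ , x₂∈ℓ , x₂≢x₁) = 1<∣p∣⇒∃∈≢ (line ℓ) (subst (1 <_) (sym (lineSize ℓ)) 2≤k) x₁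
    in x₁ , x₂ , x₁∈ℓ , x₂∈ℓ , x₂≢x₁ ∘ sym

  three-points-on : 3 ≤ k → ∀ ℓ → ∃₂ λ x₁ x₂ → ∃ λ x₃ →
    x₁ ∈ line ℓ × x₂ ∈ line ℓ × x₃ ∈ line ℓ × x₁ ≢ x₂ × x₁ ≢ x₃ × x₂ ≢ x₃
  three-points-on 3≤k ℓ =
    let (x₁ , x₂ , x₁∈ℓ , x₂∈ℓ , x₁≢x₂) = two-points-on ℓ
        ∣ℓ∣>2 = subst (2 <_) (sym (lineSize ℓ)) 3≤k
        (x₃ , x₃∈ℓ , x₃≢x₁ , x₃≢x₂) = 2<∣p∣⇒∃∈≢≢ (line ℓ) ∣ℓ∣>2 x₁ x₂
    in x₁ , x₂ , x₃ , x₁∈ℓ , x₂∈ℓ , x₃∈ℓ , x₁≢x₂ , x₃≢x₁ ∘ sym , x₃≢x₂ ∘ sym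

  line-ext : (∀ x → x ∈ line ℓ → x ∈ line ℓ') → ℓ ≡ ℓ'
  line-ext {ℓ} {ℓ'} ℓ⊆ℓ' =
    let (x₁ , x₂ , x₁∈ℓ , x₂∈ℓ , x₁≢x₂) = two-points-on ℓ
    in atMostOne x₁ x₂ x₁≢x₂ ℓ ℓ' x₁∈ℓ x₂∈ℓ (ℓ⊆ℓ' x₁ x₁∈ℓ) (ℓ⊆ℓ' x₂ x₂∈ℓ)

  Collinear-sym : Collinear x y → Collinear y x
  Collinear-sym (ℓ , x∈ℓ , y∈ℓ) = ℓ , y∈ℓ , x∈ℓ

  collinear? : ∀ x y → Dec (Collinear x y)
  collinear? x y = any? (λ ℓ → x ∈? line ℓ ×-dec y ∈? line ℓ)

  opp-unique : IsOpp x ℓ → IsOpp x ℓ' → ℓ ≡ ℓ'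
  opp-unique opp-ℓ opp-ℓ' = line-ext (λ y y∈ℓ → from (opp-ℓ' y) (to (opp-ℓ y) y∈ℓ))

  ∉opp : IsOpp x ℓ → x ∉ line ℓ
  ∉opp {x} opp-x x∈ℓ = proj₁ (to (opp-x x) x∈ℓ) refl

  opp-swap : IsOpp x ℓ → y ∈ line ℓ → IsOpp y ℓ' → x ∈ line ℓ'
  opp-swap {x} {y = y} opp-x y∈ℓ opp-y =
    let (y≢x , ¬x~y) = to (opp-x y) y∈ℓ in from (opp-y x) (y≢x ∘ sym , ¬x~y ∘ Collinear-sym)

  ∉opp⇒collinear : IsOpp x ℓ → y ∉ line ℓ → y ≢ x → Collinear x y
  ∉opp⇒collinear {x} {y = y} opp-x y∉ℓ y≢x =
    decidable-stable (collinear? x y) (λ ¬x~y → y∉ℓ (from (opp-x y) (y≢x , ¬x~y)))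

  I>0⇒∈ : 0 < I ℓ x → x ∈ line ℓ
  I>0⇒∈ {ℓ} {x} = 𝟙>0⇒ (x ∈? line ℓ)

  ∈⇒I≡1 : x ∈ line ℓ → I ℓ x ≡ 1
  ∈⇒I≡1 {x} {ℓ} = 𝟙-yes (x ∈? line ℓ)

  ∑on>0⇒ : (f : Fin v → ℕ) → 0 < ∑on ℓ f → ∃ λ z → z ∈ line ℓ × 0 < f z
  ∑on>0⇒ {ℓ} f ∑on>0 =
    let (z , pos) = positive-summand (λ z → I ℓ z * f z) ∑on>0
        (Iz>0 , fz>0) = *-pos⇒pos (I ℓ z) (f z) pos
    in z , I>0⇒∈ Iz>0 , fz>0

  common≤1 : x ≢ y → common x y ≤ 1
  common≤1 {x} {y} x≢y = begin
    common x y
      ≡⟨ sum-cong-≗ (λ ℓ → 𝟙-× (x ∈? line ℓ) (y ∈? line ℓ)) ⟨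
    sum (λ ℓ → 𝟙 (x ∈? line ℓ ×-dec y ∈? line ℓ))
      ≤⟨ sum-𝟙≤1 (λ ℓ → x ∈? line ℓ ×-dec y ∈? line ℓ)
                 (λ (x∈ℓ , y∈ℓ) (x∈ℓ' , y∈ℓ') → atMostOne x y x≢y _ _ x∈ℓ y∈ℓ x∈ℓ' y∈ℓ') ⟩
    1
      ∎
    where open ≤-Reasoning

  collinear⇒common>0 : Collinear x y → 0 < common x y
  collinear⇒common>0 {x} {y} (ℓ , x∈ℓ , y∈ℓ) =
    ≤-trans (≤-reflexive (sym (cong₂ _*_ (∈⇒I≡1 x∈ℓ) (∈⇒I≡1 y∈ℓ))))
            (summand≤sum (λ ℓ → I ℓ x * I ℓ y) ℓ)

  ¬collinear⇒common≡0 : ¬ Collinear x y → common x y ≡ 0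
  ¬collinear⇒common≡0 {x} {y} ¬x~y = n≤0⇒n≡0 (≮⇒≥ λ common>0 →
    let (ℓ , pos) = positive-summand (λ ℓ → I ℓ x * I ℓ y) common>0
        (Ix>0 , Iy>0) = *-pos⇒pos (I ℓ x) (I ℓ y) pos
    in ¬x~y (ℓ , I>0⇒∈ Ix>0 , I>0⇒∈ Iy>0))

  common-self : ∀ x → common x x ≡ r
  common-self x = trans (sum-cong-≗ (λ ℓ → 𝟙-idem (x ∈? line ℓ))) (∑I-point x)

  ∑-flags : (f : Fin v → ℕ) (g : Fin b → ℕ) →
            sum (λ y → f y * sum (λ ℓ → I ℓ y * g ℓ)) ≡ sum (λ ℓ → g ℓ * ∑on ℓ f)
  ∑-flags f g = begin
    sum (λ y → f y * sum (λ ℓ → I ℓ y * g ℓ))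
      ≡⟨ sum-cong-≗ (λ y → *-distribˡ-sum (f y) (λ ℓ → I ℓ y * g ℓ)) ⟩
    sum (λ y → sum (λ ℓ → f y * (I ℓ y * g ℓ)))
      ≡⟨ ∑-comm (λ y ℓ → f y * (I ℓ y * g ℓ)) ⟩
    sum (λ ℓ → sum (λ y → f y * (I ℓ y * g ℓ)))
      ≡⟨ sum-cong-≗ (λ ℓ → sum-cong-≗ (λ y → swap (f y) (I ℓ y) (g ℓ))) ⟩
    sum (λ ℓ → sum (λ y → g ℓ * (I ℓ y * f y)))
      ≡⟨ sum-cong-≗ (λ ℓ → *-distribˡ-sum (g ℓ) (λ y → I ℓ y * f y)) ⟨
    sum (λ ℓ → g ℓ * ∑on ℓ f)
      ∎
    where
    open ≡-Reasoning
    swap : ∀ a i c → a * (i * c) ≡ c * (i * a)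
    swap a i c = trans (*-comm a (i * c)) (trans (cong (_* a) (*-comm i c)) (*-assoc c i a))

  ∑common : ∀ x → sum (λ y → common y x) ≡ r * k
  ∑common x = begin
    sum (λ y → common y x)              ≡⟨ sum-cong-≗ (λ y → *-identityˡ (common y x)) ⟨
    sum (λ y → 1 * common y x)          ≡⟨ ∑-flags (λ _ → 1) (λ ℓ → I ℓ x) ⟩
    sum (λ ℓ → I ℓ x * ∑on ℓ (λ _ → 1)) ≡⟨ sum-cong-≗ (λ ℓ → cong (I ℓ x *_) (∑on-ones ℓ)) ⟩
    sum (λ ℓ → I ℓ x * k)               ≡⟨ *-distribʳ-sum k (λ ℓ → I ℓ x) ⟨
    sum (λ ℓ → I ℓ x) * k               ≡⟨ cong (_* k) (∑I-point x) ⟩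
    r * k                               ∎
    where
    open ≡-Reasoning
    ∑on-ones : ∀ ℓ → ∑on ℓ (λ _ → 1) ≡ k
    ∑on-ones ℓ = trans (sum-cong-≗ (λ z → *-identityʳ (I ℓ z))) (∑I-line ℓ)

  incidences-at : ∀ x y → common y x + I (opp-line x) y + 𝟙 (y ≟ x) ≤ 1 + 𝟙 (y ≟ x) * r
  incidences-at x y with y ≟ x
  ... | yes refl = ≤-reflexive (begin-equality
    common y y + I (opp-line y) y + 1
      ≡⟨ cong₂ (λ c i → c + i + 1) (common-self y)
               (𝟙-no (y ∈? line (opp-line y)) (∉opp (isOpp y))) ⟩
    r + 0 + 1
      ≡⟨ +-comm (r + 0) 1 ⟩
    1 + (r + 0)
      ∎)
    where open ≤-Reasoning
  ... | no y≢x with y ∈? line (opp-line x)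
  ...   | yes y∈xᵒ = ≤-reflexive (cong (λ c → c + 1 + 0)
                       (¬collinear⇒common≡0 (proj₂ (to (isOpp x y) y∈xᵒ) ∘ Collinear-sym)))
  ...   | no _     = ≤-trans (≤-reflexive (trans (+-identityʳ _) (+-identityʳ _))) (common≤1 y≢x)

  order-bound : Fin v → r * k + k + 1 ≤ v + r
  order-bound x = begin
    r * k + k + 1
      ≡⟨ cong₂ (λ c i → c + i + 1) (∑common x) (∑I-line (opp-line x)) ⟨
    sum (λ y → common y x) + sum (I (opp-line x)) + 1
      ≡⟨ cong₂ _+_ (∑-distrib-+ (λ y → common y x) (I (opp-line x))) (sum-𝟙-≟ x) ⟨
    sum (λ y → common y x + I (opp-line x) y) + sum (λ y → 𝟙 (y ≟ x))
      ≡⟨ ∑-distrib-+ (λ y → common y x + I (opp-line x) y) (λ y → 𝟙 (y ≟ x)) ⟨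
    sum (λ y → common y x + I (opp-line x) y + 𝟙 (y ≟ x))
      ≤⟨ sum-mono-≤ (incidences-at x) ⟩
    sum (λ y → 1 + 𝟙 (y ≟ x) * r)
      ≡⟨ ∑-distrib-+ (λ _ → 1) (λ y → 𝟙 (y ≟ x) * r) ⟩
    sum {v} (λ _ → 1) + sum (λ y → 𝟙 (y ≟ x) * r)
      ≡⟨ cong₂ _+_ (sum-ones v) (sym (*-distribʳ-sum r (λ y → 𝟙 (y ≟ x)))) ⟩
    v + sum (λ y → 𝟙 (y ≟ x)) * r
      ≡⟨ cong (λ c → v + c * r) (sum-𝟙-≟ x) ⟩
    v + 1 * r
      ≡⟨ cong (v +_) (*-identityˡ r) ⟩
    v + r
      ∎
    where open ≤-Reasoning

  OppPair-sym : OppPair l m → OppPair m l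
  OppPair-sym (l≢m , m→l , l→m) = l≢m ∘ sym , l→m , m→l

  OppPair-meet : OppPair l m → OppPair l' m' → x ∈ line l → x ∈ line l' → l ≡ l' × m ≡ m'
  OppPair-meet {m = m} (_ , m→l , l→m) (_ , m'→l' , l'→m') x∈l x∈l' =
    let m≡m' = opp-unique (l→m _ x∈l) (l'→m' _ x∈l')
        (w , w∈m) = point-on m
    in opp-unique (m→l w w∈m) (m'→l' w (subst (λ n → w ∈ line n) m≡m' w∈m)) , m≡m'

  opp-through-pair : OppPair l m → z ∈ line l → IsOpp x ℓ → z ∈ line ℓ → ℓ ≡ l
  opp-through-pair (_ , m→l , l→m) z∈l opp-x z∈ℓ =
    opp-unique opp-x (m→l _ (opp-swap opp-x z∈ℓ (l→m _ z∈l)))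

  twin-opp⇒OppPair : {o : Fin b} → x ∈ line o → x' ∈ line o → x ≢ x' →
                     IsOpp x ℓ → IsOpp x' ℓ → OppPair ℓ o
  twin-opp⇒OppPair {x} {x'} {ℓ} {o} x∈o x'∈o x≢x' opp-x opp-x' = ℓ≢o , o→ℓ , ℓ→o
    where
    ℓ→o : ∀ p → p ∈ line ℓ → IsOpp p o
    ℓ→o p p∈ℓ = subst (IsOpp p) pᵒ≡o (isOpp p)
      where
      pᵒ≡o : opp-line p ≡ o
      pᵒ≡o = atMostOne x x' x≢x' (opp-line p) o
        (opp-swap opp-x p∈ℓ (isOpp p)) (opp-swap opp-x' p∈ℓ (isOpp p)) x∈o x'∈o
    o→ℓ : ∀ w → w ∈ line o → IsOpp w ℓ
    o→ℓ w w∈o =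
      subst (IsOpp w) (sym (line-ext (λ p p∈ℓ → opp-swap (ℓ→o p p∈ℓ) w∈o (isOpp w)))) (isOpp w)
    ℓ≢o : ℓ ≢ o
    ℓ≢o ℓ≡o = let (p , p∈ℓ) = point-on ℓ in ∉opp (ℓ→o p p∈ℓ) (subst (λ n → p ∈ line n) ℓ≡o p∈ℓ)

  ∈∪? : ∀ l m x → Dec (x ∈ line l ⊎ x ∈ line m)
  ∈∪? l m x = x ∈? line l ⊎-dec x ∈? line m

  ∑𝟙∈∪ : OppPair l m → sum (λ x → 𝟙 (∈∪? l m x)) ≡ k + k
  ∑𝟙∈∪ {l} {m} (_ , _ , l→m) = begin
    sum (λ x → 𝟙 (∈∪? l m x)) ≡⟨ sum-cong-≗ (λ x → 𝟙-⊎ (x ∈? line l) (x ∈? line m) (disjoint x)) ⟩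
    sum (λ x → I l x + I m x) ≡⟨ ∑-distrib-+ (I l) (I m) ⟩
    sum (I l) + sum (I m)     ≡⟨ cong₂ _+_ (∑I-line l) (∑I-line m) ⟩
    k + k                     ∎
    where
    open ≡-Reasoning
    disjoint : ∀ x → ¬ (x ∈ line l × x ∈ line m)
    disjoint x (x∈l , x∈m) = ∉opp (l→m x x∈l) x∈m

  ∑on-∈∪≤1 : OppPair l m → y ∉ line l → y ∉ line m → y ∈ line ℓ → ∑on ℓ (λ z → 𝟙 (∈∪? l m z)) ≤ 1
  ∑on-∈∪≤1 {l} {m} {y} {ℓ} lm y∉l y∉m y∈ℓ = begin
    ∑on ℓ (λ z → 𝟙 (∈∪? l m z))
      ≡⟨ sum-cong-≗ (λ z → 𝟙-× (z ∈? line ℓ) (∈∪? l m z)) ⟨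
    sum (λ z → 𝟙 (z ∈? line ℓ ×-dec ∈∪? l m z))
      ≤⟨ sum-𝟙≤1 (λ z → z ∈? line ℓ ×-dec ∈∪? l m z) unique ⟩
    1
      ∎
    where
    open ≤-Reasoning
    same-side : ∀ {n z z'} → y ∉ line n →
                z ∈ line ℓ → z' ∈ line ℓ → z ∈ line n → z' ∈ line n → z ≢ z' → ⊥
    same-side y∉n z∈ℓ z'∈ℓ z∈n z'∈n z≢z' =
      y∉n (subst (λ n → y ∈ line n) (atMostOne _ _ z≢z' ℓ _ z∈ℓ z'∈ℓ z∈n z'∈n) y∈ℓ)
    across : ∀ {n n' z z'} → OppPair n n' → z ∈ line ℓ → z' ∈ line ℓ → z ∈ line n → z' ∈ line n' → ⊥
    across (_ , _ , n→n') z∈ℓ z'∈ℓ z∈n z'∈n' = proj₂ (to (n→n' _ z∈n _) z'∈n') (ℓ , z∈ℓ , z'∈ℓ)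
    meet : ∀ {z z'} → z ∈ line ℓ → z' ∈ line ℓ →
           (z ∈ line l ⊎ z ∈ line m) → (z' ∈ line l ⊎ z' ∈ line m) → z ≢ z' → ⊥
    meet z∈ℓ z'∈ℓ (inj₁ z∈l) (inj₁ z'∈l) = same-side y∉l z∈ℓ z'∈ℓ z∈l z'∈l
    meet z∈ℓ z'∈ℓ (inj₁ z∈l) (inj₂ z'∈m) _ = across lm z∈ℓ z'∈ℓ z∈l z'∈m
    meet z∈ℓ z'∈ℓ (inj₂ z∈m) (inj₁ z'∈l) _ = across (OppPair-sym lm) z∈ℓ z'∈ℓ z∈m z'∈l
    meet z∈ℓ z'∈ℓ (inj₂ z∈m) (inj₂ z'∈m) = same-side y∉m z∈ℓ z'∈ℓ z∈m z'∈m
    unique : ∀ {z z'} → z ∈ line ℓ × (z ∈ line l ⊎ z ∈ line m) →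
             z' ∈ line ℓ × (z' ∈ line l ⊎ z' ∈ line m) → z ≡ z'
    unique {z} {z'} (z∈ℓ , z∈lm) (z'∈ℓ , z'∈lm) =
      decidable-stable (z ≟ z') (meet z∈ℓ z'∈ℓ z∈lm z'∈lm)

  ∑on-product≤ : (f g : Fin v → ℕ) → (∀ {y z} → 0 < f y → 0 < g z → y ≢ z) →
                 sum (λ ℓ → ∑on ℓ f * ∑on ℓ g) ≤ sum f * sum g
  ∑on-product≤ f g disjoint = begin
    sum (λ ℓ → ∑on ℓ f * ∑on ℓ g)
      ≡⟨ sum-cong-≗ (λ ℓ → *-comm (∑on ℓ f) (∑on ℓ g)) ⟩
    sum (λ ℓ → ∑on ℓ g * ∑on ℓ f)
      ≡⟨ ∑-flags f (λ ℓ → ∑on ℓ g) ⟨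
    sum (λ y → f y * sum (λ ℓ → I ℓ y * ∑on ℓ g))
      ≡⟨ sum-cong-≗ (λ y → cong (f y *_) (∑-flags g (λ ℓ → I ℓ y))) ⟨
    sum (λ y → f y * sum (λ z → g z * common z y))
      ≤⟨ sum-mono-≤ (λ y → *-monoʳ-≤-pos (f y) (λ fy>0 → sum-mono-≤ (g*common≤g fy>0))) ⟩
    sum (λ y → f y * sum g)
      ≡⟨ *-distribʳ-sum (sum g) f ⟨
    sum f * sum g
      ∎
    where
    open ≤-Reasoning
    g*common≤g : ∀ {y} → 0 < f y → ∀ z → g z * common z y ≤ g z
    g*common≤g fy>0 z = ≤-trans (*-monoʳ-≤-pos (g z) (λ gz>0 → common≤1 (disjoint fy>0 gz>0 ∘ sym)))
                                (≤-reflexive (*-identityʳ (g z)))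

-- Two opposite line pairs

m+n+[m+n≡0]≤1+m*n : ∀ {m n} → m ≤ 1 → n ≤ 1 → m + n + 𝟙 (m + n Nat.≟ 0) ≤ 1 + m * n
m+n+[m+n≡0]≤1+m*n z≤n       z≤n       = ≤-refl
m+n+[m+n≡0]≤1+m*n z≤n       (s≤s z≤n) = ≤-refl
m+n+[m+n≡0]≤1+m*n (s≤s z≤n) z≤n       = ≤-refl
m+n+[m+n≡0]≤1+m*n (s≤s z≤n) (s≤s z≤n) = ≤-refl

module TwoOppPairs {r : ℕ} (P : PENT 3 r)
  (l₁ m₁ l₂ m₂ : Fin (PENT.b P)) (pair₁ : PENT.OppPair P l₁ m₁) (pair₂ : PENT.OppPair P l₂ m₂)
  (pairs-differ : ¬ ((l₁ ≡ l₂ × m₁ ≡ m₂) ⊎ (l₁ ≡ m₂ × m₁ ≡ l₂)))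
  (only-pairs : ∀ l m → PENT.OppPair P l m →
     (l ≡ l₁ × m ≡ m₁) ⊎ (l ≡ m₁ × m ≡ l₁) ⊎ (l ≡ l₂ × m ≡ m₂) ⊎ (l ≡ m₂ × m ≡ l₂))
  where
  open PENT P
  open PentagonalGeometry P (s≤s (s≤s z≤n))

  private
    variable
      x y z : Fin v
      l m ℓ : Fin b

  In₁ In₂ InA : Fin v → Set
  In₁ x = x ∈ line l₁ ⊎ x ∈ line m₁
  In₂ x = x ∈ line l₂ ⊎ x ∈ line m₂
  InA x = In₁ x ⊎ In₂ x

  inA? : ∀ x → Dec (InA x)
  inA? x = ∈∪? l₁ m₁ x ⊎-dec ∈∪? l₂ m₂ x

  χ₁ χ₂ χA χB : Fin v → ℕ
  χ₁ x = 𝟙 (∈∪? l₁ m₁ x)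
  χ₂ x = 𝟙 (∈∪? l₂ m₂ x)
  χA x = 𝟙 (inA? x)
  χB x = 𝟙 (¬? (inA? x))

  α₁ α₂ : Fin b → ℕ
  α₁ ℓ = ∑on ℓ χ₁
  α₂ ℓ = ∑on ℓ χ₂

  t : Fin v → ℕ
  t y = sum (λ ℓ → I ℓ y * (α₁ ℓ * α₂ ℓ))

  IsPairLine : Fin b → Set
  IsPairLine ℓ = ℓ ≡ l₁ ⊎ ℓ ≡ m₁ ⊎ ℓ ≡ l₂ ⊎ ℓ ≡ m₂

  pair-line⇒InA : IsPairLine ℓ → x ∈ line ℓ → InA x
  pair-line⇒InA (inj₁ refl)               x∈ℓ = inj₁ (inj₁ x∈ℓ)
  pair-line⇒InA (inj₂ (inj₁ refl))        x∈ℓ = inj₁ (inj₂ x∈ℓ)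
  pair-line⇒InA (inj₂ (inj₂ (inj₁ refl))) x∈ℓ = inj₂ (inj₁ x∈ℓ)
  pair-line⇒InA (inj₂ (inj₂ (inj₂ refl))) x∈ℓ = inj₂ (inj₂ x∈ℓ)

  OppPair⇒pair-line : OppPair l m → IsPairLine l
  OppPair⇒pair-line {l} {m} lm with only-pairs l m lm
  ... | inj₁ (l≡l₁ , _)               = inj₁ l≡l₁
  ... | inj₂ (inj₁ (l≡m₁ , _))        = inj₂ (inj₁ l≡m₁)
  ... | inj₂ (inj₂ (inj₁ (l≡l₂ , _))) = inj₂ (inj₂ (inj₁ l≡l₂))
  ... | inj₂ (inj₂ (inj₂ (l≡m₂ , _))) = inj₂ (inj₂ (inj₂ l≡m₂))

  pair-through : InA z → ∃₂ λ l m → OppPair l m × z ∈ line l × IsPairLine l × IsPairLine m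
  pair-through (inj₁ (inj₁ z∈l₁)) =
    l₁ , m₁ , pair₁ , z∈l₁ , inj₁ refl , inj₂ (inj₁ refl)
  pair-through (inj₁ (inj₂ z∈m₁)) =
    m₁ , l₁ , OppPair-sym pair₁ , z∈m₁ , inj₂ (inj₁ refl) , inj₁ refl
  pair-through (inj₂ (inj₁ z∈l₂)) =
    l₂ , m₂ , pair₂ , z∈l₂ , inj₂ (inj₂ (inj₁ refl)) , inj₂ (inj₂ (inj₂ refl))
  pair-through (inj₂ (inj₂ z∈m₂)) =
    m₂ , l₂ , OppPair-sym pair₂ , z∈m₂ , inj₂ (inj₂ (inj₂ refl)) , inj₂ (inj₂ (inj₁ refl))

  opp-meeting-A⇒pair-line : InA z → IsOpp x ℓ → z ∈ line ℓ → IsPairLine ℓ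
  opp-meeting-A⇒pair-line z∈A opp-x z∈ℓ =
    let (l , _ , lm , z∈l , l-pair , _) = pair-through z∈A
    in subst IsPairLine (sym (opp-through-pair lm z∈l opp-x z∈ℓ)) l-pair

  collinear-with-A : ¬ InA y → InA z → Collinear y z
  collinear-with-A y∉A z∈A =
    let (_ , m , (_ , _ , l→m) , z∈l , _ , m-pair) = pair-through z∈A
    in Collinear-sym (∉opp⇒collinear (l→m _ z∈l) (y∉A ∘ pair-line⇒InA m-pair)
                                     (λ y≡z → y∉A (subst InA (sym y≡z) z∈A)))

  In₁∩In₂≡∅ : In₁ x → In₂ x → ⊥
  In₁∩In₂≡∅ (inj₁ x∈l₁) (inj₁ x∈l₂) =
    pairs-differ (inj₁ (OppPair-meet pair₁ pair₂ x∈l₁ x∈l₂))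
  In₁∩In₂≡∅ (inj₁ x∈l₁) (inj₂ x∈m₂) =
    pairs-differ (inj₂ (OppPair-meet pair₁ (OppPair-sym pair₂) x∈l₁ x∈m₂))
  In₁∩In₂≡∅ (inj₂ x∈m₁) (inj₁ x∈l₂) =
    let (m₁≡l₂ , l₁≡m₂) = OppPair-meet (OppPair-sym pair₁) pair₂ x∈m₁ x∈l₂
    in pairs-differ (inj₂ (l₁≡m₂ , m₁≡l₂))
  In₁∩In₂≡∅ (inj₂ x∈m₁) (inj₂ x∈m₂) =
    let (m₁≡m₂ , l₁≡l₂) = OppPair-meet (OppPair-sym pair₁) (OppPair-sym pair₂) x∈m₁ x∈m₂
    in pairs-differ (inj₁ (l₁≡l₂ , m₁≡m₂))

  χA≡χ₁+χ₂ : ∀ x → χA x ≡ χ₁ x + χ₂ x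
  χA≡χ₁+χ₂ x = 𝟙-⊎ (∈∪? l₁ m₁ x) (∈∪? l₂ m₂ x) (λ (x∈₁ , x∈₂) → In₁∩In₂≡∅ x∈₁ x∈₂)

  ∑χA : sum χA ≡ 12
  ∑χA = trans (sum-cong-≗ χA≡χ₁+χ₂)
              (trans (∑-distrib-+ χ₁ χ₂) (cong₂ _+_ (∑𝟙∈∪ pair₁) (∑𝟙∈∪ pair₂)))

  v≡∑χB+12 : v ≡ sum χB + 12
  v≡∑χB+12 = begin
    v                       ≡⟨ sum-ones v ⟨
    sum {v} (λ _ → 1)       ≡⟨ sum-cong-≗ (λ x → 𝟙-¬ (inA? x)) ⟨
    sum (λ x → χB x + χA x) ≡⟨ ∑-distrib-+ χB χA ⟩
    sum χB + sum χA         ≡⟨ cong (sum χB +_) ∑χA ⟩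
    sum χB + 12             ∎
    where open ≡-Reasoning

  ∑on-χA : ∀ ℓ → ∑on ℓ χA ≡ α₁ ℓ + α₂ ℓ
  ∑on-χA ℓ = trans (sum-cong-≗ split) (∑-distrib-+ (λ z → I ℓ z * χ₁ z) (λ z → I ℓ z * χ₂ z))
    where
    split : ∀ z → I ℓ z * χA z ≡ I ℓ z * χ₁ z + I ℓ z * χ₂ z
    split z = trans (cong (I ℓ z *_) (χA≡χ₁+χ₂ z)) (*-distribˡ-+ (I ℓ z) (χ₁ z) (χ₂ z))

  ∑on-χB+∑on-χA : ∀ ℓ → ∑on ℓ χB + ∑on ℓ χA ≡ 3
  ∑on-χB+∑on-χA ℓ = begin
    ∑on ℓ χB + ∑on ℓ χA
      ≡⟨ ∑-distrib-+ (λ z → I ℓ z * χB z) (λ z → I ℓ z * χA z) ⟨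
    sum (λ z → I ℓ z * χB z + I ℓ z * χA z)
      ≡⟨ sum-cong-≗ (λ z → *-distribˡ-+ (I ℓ z) (χB z) (χA z)) ⟨
    sum (λ z → I ℓ z * (χB z + χA z))
      ≡⟨ sum-cong-≗ (λ z → trans (cong (I ℓ z *_) (𝟙-¬ (inA? z))) (*-identityʳ (I ℓ z))) ⟩
    sum (I ℓ)
      ≡⟨ ∑I-line ℓ ⟩
    3
      ∎
    where open ≡-Reasoning

  2≤∑on-χA : ∀ ℓ → 0 < α₁ ℓ → 0 < α₂ ℓ → 2 ≤ ∑on ℓ χA
  2≤∑on-χA ℓ α₁>0 α₂>0 =
    let (z₁ , z₁∈ℓ , χ₁z₁>0) = ∑on>0⇒ χ₁ α₁>0
        (z₂ , z₂∈ℓ , χ₂z₂>0) = ∑on>0⇒ χ₂ α₂>0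
        z₁∈₁ = 𝟙>0⇒ (∈∪? l₁ m₁ z₁) χ₁z₁>0
        z₂∈₂ = 𝟙>0⇒ (∈∪? l₂ m₂ z₂) χ₂z₂>0
    in two-positive-summands (λ z → I ℓ z * χA z)
         (λ z₁≡z₂ → In₁∩In₂≡∅ z₁∈₁ (subst In₂ (sym z₁≡z₂) z₂∈₂))
         (on-A z₁∈ℓ (inj₁ z₁∈₁)) (on-A z₂∈ℓ (inj₂ z₂∈₂))
    where
    on-A : z ∈ line ℓ → InA z → 0 < I ℓ z * χA z
    on-A {z} z∈ℓ z∈A = ≤-reflexive (sym (cong₂ _*_ (∈⇒I≡1 z∈ℓ) (𝟙-yes (inA? z) z∈A)))

  ∑on-χB≤1 : ∀ ℓ → 0 < α₁ ℓ * α₂ ℓ → ∑on ℓ χB ≤ 1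
  ∑on-χB≤1 ℓ α₁α₂>0 =
    let (α₁>0 , α₂>0) = *-pos⇒pos (α₁ ℓ) (α₂ ℓ) α₁α₂>0
    in +-cancelʳ-≤ 2 (∑on ℓ χB) 1
         (≤-trans (+-monoʳ-≤ (∑on ℓ χB) (2≤∑on-χA ℓ α₁>0 α₂>0)) (≤-reflexive (∑on-χB+∑on-χA ℓ)))

  ∑χB*t≤36 : sum (λ y → χB y * t y) ≤ 36
  ∑χB*t≤36 = begin
    sum (λ y → χB y * t y)             ≡⟨ ∑-flags χB (λ ℓ → α₁ ℓ * α₂ ℓ) ⟩
    sum (λ ℓ → α₁ ℓ * α₂ ℓ * ∑on ℓ χB) ≤⟨ sum-mono-≤ at-most-one-in-B ⟩
    sum (λ ℓ → α₁ ℓ * α₂ ℓ)            ≤⟨ ∑on-product≤ χ₁ χ₂ disjoint ⟩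
    sum χ₁ * sum χ₂                    ≡⟨ cong₂ _*_ (∑𝟙∈∪ pair₁) (∑𝟙∈∪ pair₂) ⟩
    36                                 ∎
    where
    open ≤-Reasoning
    at-most-one-in-B : ∀ ℓ → α₁ ℓ * α₂ ℓ * ∑on ℓ χB ≤ α₁ ℓ * α₂ ℓ
    at-most-one-in-B ℓ =
      ≤-trans (*-monoʳ-≤-pos (α₁ ℓ * α₂ ℓ) (∑on-χB≤1 ℓ)) (≤-reflexive (*-identityʳ (α₁ ℓ * α₂ ℓ)))
    disjoint : 0 < χ₁ y → 0 < χ₂ z → y ≢ z
    disjoint {y} {z} χ₁y>0 χ₂z>0 y≡z =
      In₁∩In₂≡∅ (𝟙>0⇒ (∈∪? l₁ m₁ y) χ₁y>0) (subst In₂ (sym y≡z) (𝟙>0⇒ (∈∪? l₂ m₂ z) χ₂z>0))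

  module OutsidePoint {y : Fin v} (y∉A : ¬ InA y) where

    misses-A : Fin b → ℕ
    misses-A ℓ = 𝟙 (α₁ ℓ + α₂ ℓ Nat.≟ 0)

    12≤∑I*α : 12 ≤ sum (λ ℓ → I ℓ y * (α₁ ℓ + α₂ ℓ))
    12≤∑I*α = begin
      12                                ≡⟨ ∑χA ⟨
      sum χA                            ≤⟨ sum-mono-≤ (λ z → m≤m*n-pos _ _ (seen-from-y z)) ⟩
      sum (λ z → χA z * common z y)     ≡⟨ ∑-flags χA (λ ℓ → I ℓ y) ⟩
      sum (λ ℓ → I ℓ y * ∑on ℓ χA)      ≡⟨ sum-cong-≗ (λ ℓ → cong (I ℓ y *_) (∑on-χA ℓ)) ⟩
      sum (λ ℓ → I ℓ y * (α₁ ℓ + α₂ ℓ)) ∎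
      where
      open ≤-Reasoning
      seen-from-y : ∀ z → 0 < χA z → 0 < common z y
      seen-from-y z χAz>0 =
        collinear⇒common>0 (Collinear-sym (collinear-with-A y∉A (𝟙>0⇒ (inA? z) χAz>0)))

    through-y : ∀ ℓ → I ℓ y * (α₁ ℓ + α₂ ℓ) + I ℓ y * misses-A ℓ ≤ I ℓ y * (1 + α₁ ℓ * α₂ ℓ)
    through-y ℓ = ≤-trans (≤-reflexive (sym (*-distribˡ-+ (I ℓ y) (α₁ ℓ + α₂ ℓ) (misses-A ℓ))))
      (*-monoʳ-≤-pos (I ℓ y) (λ Iy>0 → m+n+[m+n≡0]≤1+m*n (α₁≤1 (I>0⇒∈ Iy>0)) (α₂≤1 (I>0⇒∈ Iy>0))))
      where
      α₁≤1 : y ∈ line ℓ → α₁ ℓ ≤ 1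
      α₁≤1 = ∑on-∈∪≤1 pair₁ (y∉A ∘ inj₁ ∘ inj₁) (y∉A ∘ inj₁ ∘ inj₂)
      α₂≤1 : y ∈ line ℓ → α₂ ℓ ≤ 1
      α₂≤1 = ∑on-∈∪≤1 pair₂ (y∉A ∘ inj₂ ∘ inj₁) (y∉A ∘ inj₂ ∘ inj₂)

    y∈xᵒ : x ∈ line (opp-line y) → y ∈ line (opp-line x)
    y∈xᵒ {x} x∈yᵒ = opp-swap (isOpp y) x∈yᵒ (isOpp x)

    xᵒ-misses-A : x ∈ line (opp-line y) → 0 < I (opp-line x) y * misses-A (opp-line x)
    xᵒ-misses-A {x} x∈yᵒ =
      ≤-reflexive (sym (cong₂ _*_ (∈⇒I≡1 (y∈xᵒ x∈yᵒ)) (𝟙-yes (α₁ xᵒ + α₂ xᵒ Nat.≟ 0) no-hits)))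
      where
      xᵒ : Fin b
      xᵒ = opp-line x
      no-hits : α₁ xᵒ + α₂ xᵒ ≡ 0
      no-hits = n≤0⇒n≡0 (≮⇒≥ λ hits>0 →
        let (z , z∈xᵒ , χAz>0) = ∑on>0⇒ χA (subst (0 <_) (sym (∑on-χA xᵒ)) hits>0)
            xᵒ-pair = opp-meeting-A⇒pair-line (𝟙>0⇒ (inA? z) χAz>0) (isOpp x) z∈xᵒ
        in y∉A (pair-line⇒InA xᵒ-pair (y∈xᵒ x∈yᵒ)))

    opp-line-injective : {x x' : Fin v} → x ∈ line (opp-line y) → x' ∈ line (opp-line y) → x ≢ x' →
                         opp-line x ≢ opp-line x'
    opp-line-injective {x} {x'} x∈yᵒ x'∈yᵒ x≢x' xᵒ≡x'ᵒ =
      let x'-opp-xᵒ = subst (IsOpp x') (sym xᵒ≡x'ᵒ) (isOpp x')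
          pair = twin-opp⇒OppPair x∈yᵒ x'∈yᵒ x≢x' (isOpp x) x'-opp-xᵒ
      in y∉A (pair-line⇒InA (OppPair⇒pair-line pair) (y∈xᵒ x∈yᵒ))

    3≤∑I*misses : 3 ≤ sum (λ ℓ → I ℓ y * misses-A ℓ)
    3≤∑I*misses =
      let (x₁ , x₂ , x₃ , x₁∈yᵒ , x₂∈yᵒ , x₃∈yᵒ , x₁≢x₂ , x₁≢x₃ , x₂≢x₃) =
            three-points-on ≤-refl (opp-line y)
      in three-positive-summands (λ ℓ → I ℓ y * misses-A ℓ)
           (opp-line-injective x₁∈yᵒ x₂∈yᵒ x₁≢x₂)
           (opp-line-injective x₁∈yᵒ x₃∈yᵒ x₁≢x₃)
           (opp-line-injective x₂∈yᵒ x₃∈yᵒ x₂≢x₃)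
           (xᵒ-misses-A x₁∈yᵒ) (xᵒ-misses-A x₂∈yᵒ) (xᵒ-misses-A x₃∈yᵒ)

    15≤r+t : 15 ≤ r + t y
    15≤r+t = begin
      12 + 3
        ≤⟨ +-mono-≤ 12≤∑I*α 3≤∑I*misses ⟩
      sum (λ ℓ → I ℓ y * (α₁ ℓ + α₂ ℓ)) + sum (λ ℓ → I ℓ y * misses-A ℓ)
        ≡⟨ ∑-distrib-+ (λ ℓ → I ℓ y * (α₁ ℓ + α₂ ℓ)) (λ ℓ → I ℓ y * misses-A ℓ) ⟨
      sum (λ ℓ → I ℓ y * (α₁ ℓ + α₂ ℓ) + I ℓ y * misses-A ℓ)
        ≤⟨ sum-mono-≤ through-y ⟩
      sum (λ ℓ → I ℓ y * (1 + α₁ ℓ * α₂ ℓ))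
        ≡⟨ sum-cong-≗ (λ ℓ → *-distribˡ-+ (I ℓ y) 1 (α₁ ℓ * α₂ ℓ)) ⟩
      sum (λ ℓ → I ℓ y * 1 + I ℓ y * (α₁ ℓ * α₂ ℓ))
        ≡⟨ ∑-distrib-+ (λ ℓ → I ℓ y * 1) (λ ℓ → I ℓ y * (α₁ ℓ * α₂ ℓ)) ⟩
      sum (λ ℓ → I ℓ y * 1) + t y
        ≡⟨ cong (_+ t y) (trans (sum-cong-≗ (λ ℓ → *-identityʳ (I ℓ y))) (∑I-point y)) ⟩
      r + t y
        ∎
      where open ≤-Reasoning

  ∑χB*[15∸r]≤36 : sum χB * (15 ∸ r) ≤ 36
  ∑χB*[15∸r]≤36 = begin
    sum χB * (15 ∸ r)           ≡⟨ *-distribʳ-sum (15 ∸ r) χB ⟩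
    sum (λ y → χB y * (15 ∸ r)) ≤⟨ sum-mono-≤ (λ y → *-monoʳ-≤-pos (χB y) (15∸r≤t y)) ⟩
    sum (λ y → χB y * t y)      ≤⟨ ∑χB*t≤36 ⟩
    36                          ∎
    where
    open ≤-Reasoning
    15∸r≤t : ∀ y → 0 < χB y → 15 ∸ r ≤ t y
    15∸r≤t y χBy>0 = m≤n+o⇒m∸n≤o 15 r (OutsidePoint.15≤r+t (𝟙>0⇒ (¬? (inA? y)) χBy>0))

-- The first hypothesis is c ≤ β written so that, for a numeral r and c = 2r − 8, it is
-- definitionally the bound r * 3 + 3 + 1 ≤ β + 12 + r that no-such-r receives.
excess : ∀ r c {β} → c + 12 + r ≤ β + 12 + r → β * (15 ∸ r) ≤ 36 → c * (15 ∸ r) ≤ 36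
excess r c {β} c≤β β*[15∸r]≤36 =
  ≤-trans (*-monoˡ-≤ (15 ∸ r) (+-cancelʳ-≤ 12 c β (+-cancelʳ-≤ r (c + 12) (β + 12) c≤β)))
          β*[15∸r]≤36

no-such-r : ∀ {r β} → (r ≡ 7 ⊎ r ≡ 9 ⊎ r ≡ 10 ⊎ r ≡ 12) →
            r * 3 + 3 + 1 ≤ β + 12 + r → β * (15 ∸ r) ≤ 36 → ⊥
no-such-r (inj₁ refl)               lower upper = from-no (48 ≤? 36) (excess 7 6 lower upper)
no-such-r (inj₂ (inj₁ refl))        lower upper = from-no (60 ≤? 36) (excess 9 10 lower upper)
no-such-r (inj₂ (inj₂ (inj₁ refl))) lower upper = from-no (60 ≤? 36) (excess 10 12 lower upper)
no-such-r (inj₂ (inj₂ (inj₂ refl))) lower upper = from-no (48 ≤? 36) (excess 12 16 lower upper)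

theorem3p1 : (r : ℕ) → (r ≡ 7 ⊎ r ≡ 9 ⊎ r ≡ 10 ⊎ r ≡ 12) →
    (P : PENT 3 r) → ¬ ExactlyTwoOppPairs P
theorem3p1 r r∈ P (l₁ , m₁ , l₂ , m₂ , pair₁ , pair₂ , pairs-differ , only-pairs) =
  no-such-r r∈ (≤-trans (order-bound (proj₁ (point-on l₁))) (≤-reflexive (cong (_+ r) v≡∑χB+12)))
               ∑χB*[15∸r]≤36
  where
  open TwoOppPairs P l₁ m₁ l₂ m₂ pair₁ pair₂ pairs-differ only-pairs
  open PentagonalGeometry P (s≤s (s≤s z≤n)) using (order-bound; point-on)
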